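{- Fix an integer $d\geq2$. The two partial differential equations $D_LF=D_RF$ and $\tilde D_LF=\tilde D_RF$ have at most one common solution $F\in\mathbf{R}$ satisfying $F\equiv1+tx\pmod{x^2}$.
   Context: $\mathbf{R}=\left(\mathbb{Q}[t,t^{ -1}]\right)[[x]]$. Let $\theta_t=t\frac{\partial}{\partial t}$, $\theta_x=x\frac{\partial}{\partial x}$ act on $\mathbf{R}$. Define (products are compositions; prefactors act by multiplication after the differential parts): $D_L=dtx\left(1-\frac{d+1}{2}\theta_t+\frac{d-1}{2}\theta_x\right)\prod_{j=1}^{d-1}\left(j+\frac d2\theta_t+\frac d2\theta_x\right)$, $D_R=\prod_{j=0}^{d-1}\left(-j+\frac{d+1}{2}\theta_t+\frac{d-1}{2}\theta_x\right)$, $\tilde D_L=dx\left(\frac{d+1}{2}\theta_t+\frac{d-1}{2}\theta_x\right)\prod_{j=1}^{d-1}\left(j-\frac d2\theta_t+\frac d2\theta_x\right)$, $\tilde D_R=t\prod_{j=0}^{d-1}\left(1-j-\frac{d+1}{2}\theta_t+\frac{d-1}{2}\theta_x\right)$. -}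

module Defs where

open import Data.Nat as ℕ using (ℕ; zero; suc; _∸_)
open import Data.Integer as ℤ using (ℤ; +_)
open import Data.Rational as ℚ using (ℚ; 0ℚ; 1ℚ; _/_)
open import Data.Product using (∃; _×_)
open import Relation.Binary.PropositionalEquality using (_≡_)
open import Relation.Nullary using (¬_)
open import Function using (_∘_; id)

-- Ambient coefficient space: F ↦ (n, a) ↦ coefficient of t^a x^n.
Coeffs : Set
Coeffs = ℕ → ℤ → ℚ

-- Elements of R = (ℚ[t,t⁻¹])[[x]]: every x^n-coefficient is a Laurent
-- polynomial in t, i.e. has finite support in the t-exponent.
record R : Set where
  field
    coeff      : Coeffs
    laurent    : ∀ n → ∃ λ (B : ℕ) → ∀ a → ℕ._<_ B ℤ.∣ a ∣ → coeff n a ≡ 0ℚ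
open R public

Op : Set
Op = Coeffs → Coeffs

ℕtoℚ : ℕ → ℚ
ℕtoℚ n = (+ n) / 1

ℤtoℚ : ℤ → ℚ
ℤtoℚ a = a / 1

-- θ_t = t ∂/∂t,  θ_x = x ∂/∂x
θt : Op
θt F n a = ℚ._*_ (ℤtoℚ a) (F n a)

θx : Op
θx F n a = ℚ._*_ (ℕtoℚ n) (F n a)

scal : ℚ → Op
scal c F n a = ℚ._*_ c (F n a)

mulT : Op
mulT F n a = F n (ℤ._-_ a (+ 1))

mulX : Op
mulX F zero    a = 0ℚ
mulX F (suc n) a = F n a

lin : ℚ → ℚ → ℚ → Op
lin α β γ F n a = ℚ._+_ (ℚ._+_ (scal α F n a) (scal β (θt F) n a)) (scal γ (θx F) n a)

prodFrom : (ℕ → Op) → ℕ → ℕ → Op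
prodFrom f s zero    = id
prodFrom f s (suc k) = f s ∘ prodFrom f (suc s) k

half : ℕ → ℚ
half m = (+ m) / 2

module _ (d : ℕ) where
  D-L : Op
  D-L = scal (ℕtoℚ d) ∘ mulT ∘ mulX
        ∘ lin 1ℚ (ℚ.-_ (half (suc d))) (half (d ∸ 1))
        ∘ prodFrom (λ j → lin (ℕtoℚ j) (half d) (half d)) 1 (d ∸ 1)

  D-R : Op
  D-R = prodFrom (λ j → lin (ℚ.-_ (ℕtoℚ j)) (half (suc d)) (half (d ∸ 1))) 0 d

  D̃-L : Op
  D̃-L = scal (ℕtoℚ d) ∘ mulX
        ∘ lin 0ℚ (half (suc d)) (half (d ∸ 1))
        ∘ prodFrom (λ j → lin (ℕtoℚ j) (ℚ.-_ (half d)) (half d)) 1 (d ∸ 1)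

  D̃-R : Op
  D̃-R = mulT
        ∘ prodFrom (λ j → lin (ℚ._-_ 1ℚ (ℕtoℚ j)) (ℚ.-_ (half (suc d))) (half (d ∸ 1))) 0 d

_≈R_ : R → R → Set
F ≈R G = ∀ n a → coeff F n a ≡ coeff G n a

δ : ℤ → ℤ → ℚ
δ a b with a ℤ.≟ b
... | Relation.Nullary.yes _ = 1ℚ
... | Relation.Nullary.no _  = 0ℚ

InitCond : R → Set
InitCond F = (∀ a → coeff F 0 a ≡ δ a (+ 0)) × (∀ a → coeff F 1 a ≡ δ a (+ 1))

Solves : ℕ → R → Set
Solves d F = (∀ n a → D-L d (coeff F) n a ≡ D-R d (coeff F) n a)
           × (∀ n a → D̃-L d (coeff F) n a ≡ D̃-R d (coeff F) n a)

-- Every operator built from scalars, θ_t and θ_x is *diagonal*: it multiplies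
-- the coefficient F_{n,a} of t^a x^n by a symbol σ(n, a).  Thus D_R is
-- diagonal, D̃_R is diagonal up to a shift in t, and, because of their factor
-- x, the x^(n+1)-coefficients of D_L F and D̃_L F only involve the
-- x^n-coefficients of F.  Hence, at a level n ≥ 2, the two equations determine
-- σ_R(n,a)·F_{n,a} and σ̃_R(n,a)·F_{n,a} from the level below.  Both symbols
-- are products of linear factors, and factors j of σ_R and i of σ̃_R vanishing
-- together would force i + j = 1 + (d-1)n, impossible for i, j ≤ d-1, n ≥ 2.
-- So one of the symbols is nonzero and F_{n,a} is determined; induction on n
-- from the initial condition gives uniqueness.
module Submission where

open import Defs
open import Data.Nat using (ℕ; _≤_)
open import Data.Nat as ℕ using (zero; suc; _<_; s≤s)
import Data.Nat.Properties as ℕP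
open import Data.Integer as ℤ using (ℤ; +_)
import Data.Integer.Properties as ℤP
open import Data.Integer.Solver renaming (module +-*-Solver to ℤ-Solver)
open import Data.Rational as ℚ using (ℚ; 0ℚ; 1ℚ; toℚᵘ; _+_; _*_; -_; _-_; 1/_)
import Data.Rational.Properties as ℚP
open import Data.Rational.Solver renaming (module +-*-Solver to ℚ-Solver)
open import Data.Rational.Unnormalised as ℚᵘ using (mkℚᵘ; *≡*) renaming (_≃_ to _≃ᵘ_)
import Data.Rational.Unnormalised.Properties as ℚᵘP
open import Data.Product using (Σ-syntax; _×_; _,_; proj₁; proj₂)
open import Data.Sum using (_⊎_; inj₁; inj₂)
open import Relation.Binary.PropositionalEquality
  using (_≡_; _≢_; refl; sym; trans; cong; cong₂; subst; module ≡-Reasoning)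
open import Relation.Nullary using (¬_; yes; no; contradiction)
open import Function using (_∘_)

*-cancelˡ-≢0 : ∀ p x y → p ≢ 0ℚ → p * x ≡ p * y → x ≡ y
*-cancelˡ-≢0 p x y p≢0 px≡py = begin
  x                ≡⟨ sym (ℚP.*-identityˡ x) ⟩
  1ℚ * x           ≡⟨ cong (_* x) (sym (ℚP.*-inverseˡ p)) ⟩
  (1/ p * p) * x   ≡⟨ ℚP.*-assoc (1/ p) p x ⟩
  1/ p * (p * x)   ≡⟨ cong (1/ p *_) px≡py ⟩
  1/ p * (p * y)   ≡⟨ sym (ℚP.*-assoc (1/ p) p y) ⟩
  (1/ p * p) * y   ≡⟨ cong (_* y) (ℚP.*-inverseˡ p) ⟩
  1ℚ * y           ≡⟨ ℚP.*-identityˡ y ⟩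
  y                ∎
  where
  open ≡-Reasoning
  instance _ = ℚ.≢-nonZero p≢0

*-zero-product : ∀ x y → x * y ≡ 0ℚ → x ≡ 0ℚ ⊎ y ≡ 0ℚ
*-zero-product x y xy≡0 with x ℚP.≟ 0ℚ
... | yes x≡0 = inj₁ x≡0
... | no  x≢0 = inj₂ (*-cancelˡ-≢0 x y 0ℚ x≢0 (trans xy≡0 (sym (ℚP.*-zeroʳ x))))

cancel-by-either : ∀ p q x y → ¬ (p ≡ 0ℚ × q ≡ 0ℚ) →
                   p * x ≡ p * y → q * x ≡ q * y → x ≡ y
cancel-by-either p q x y apart px≡py qx≡qy with p ℚP.≟ 0ℚ | q ℚP.≟ 0ℚ
... | no  p≢0 | _       = *-cancelˡ-≢0 p x y p≢0 px≡py
... | yes _   | no  q≢0 = *-cancelˡ-≢0 q x y q≢0 qx≡qy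
... | yes p≡0 | yes q≡0 = contradiction (p≡0 , q≡0) apart

-- The embedding ℕ → ℚ is an injective semiring homomorphism; equalities are
-- checked on unnormalised representatives, where they become integer identities.
ℕtoℚ≃ : ∀ n → toℚᵘ (ℕtoℚ n) ≃ᵘ mkℚᵘ (+ n) 0
ℕtoℚ≃ n = ℚP.toℚᵘ-fromℚᵘ (mkℚᵘ (+ n) 0)

half≃ : ∀ n → toℚᵘ (half n) ≃ᵘ mkℚᵘ (+ n) 1
half≃ n = ℚP.toℚᵘ-fromℚᵘ (mkℚᵘ (+ n) 1)

≡-via-ℚᵘ : ∀ {p q} u → toℚᵘ p ≃ᵘ u → toℚᵘ q ≃ᵘ u → p ≡ q
≡-via-ℚᵘ u p≃u q≃u = ℚP.toℚᵘ-injective (ℚᵘP.≃-trans p≃u (ℚᵘP.≃-sym q≃u))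

ℕtoℚ-injective : ∀ m n → ℕtoℚ m ≡ ℕtoℚ n → m ≡ n
ℕtoℚ-injective m n eq with ℚᵘP.≃-trans (ℚᵘP.≃-sym (ℕtoℚ≃ m))
                             (ℚᵘP.≃-trans (ℚᵘP.≃-reflexive (cong toℚᵘ eq)) (ℕtoℚ≃ n))
... | *≡* m*1≡n*1 = ℤP.+-injective
  (trans (sym (ℤP.*-identityʳ (+ m))) (trans m*1≡n*1 (ℤP.*-identityʳ (+ n))))

ℕtoℚ-+ : ∀ m n → ℕtoℚ (m ℕ.+ n) ≡ ℕtoℚ m + ℕtoℚ n
ℕtoℚ-+ m n = ≡-via-ℚᵘ (mkℚᵘ (+ m) 0 ℚᵘ.+ mkℚᵘ (+ n) 0)
  (ℚᵘP.≃-trans (ℕtoℚ≃ (m ℕ.+ n)) (*≡* integer-identity))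
  (ℚᵘP.≃-trans (ℚP.toℚᵘ-homo-+ (ℕtoℚ m) (ℕtoℚ n)) (ℚᵘP.+-cong (ℕtoℚ≃ m) (ℕtoℚ≃ n)))
  where
  open ℤ-Solver
  integer-identity : + (m ℕ.+ n) ℤ.* + 1 ≡ (+ m ℤ.* + 1 ℤ.+ + n ℤ.* + 1) ℤ.* + 1
  integer-identity rewrite ℤP.pos-+ m n =
    solve 2 (λ x y → (x :+ y) :* con (+ 1) := (x :* con (+ 1) :+ y :* con (+ 1)) :* con (+ 1))
      refl (+ m) (+ n)

ℕtoℚ-* : ∀ m n → ℕtoℚ (m ℕ.* n) ≡ ℕtoℚ m * ℕtoℚ n
ℕtoℚ-* m n = ≡-via-ℚᵘ (mkℚᵘ (+ m) 0 ℚᵘ.* mkℚᵘ (+ n) 0)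
  (ℚᵘP.≃-trans (ℕtoℚ≃ (m ℕ.* n)) (*≡* integer-identity))
  (ℚᵘP.≃-trans (ℚP.toℚᵘ-homo-* (ℕtoℚ m) (ℕtoℚ n)) (ℚᵘP.*-cong (ℕtoℚ≃ m) (ℕtoℚ≃ n)))
  where
  integer-identity : + (m ℕ.* n) ℤ.* + 1 ≡ (+ m ℤ.* + n) ℤ.* + 1
  integer-identity = cong (ℤ._* + 1) (ℤP.pos-* m n)

half-+-half : ∀ n → half n + half n ≡ ℕtoℚ n
half-+-half n = ≡-via-ℚᵘ (mkℚᵘ (+ n) 0)
  (ℚᵘP.≃-trans (ℚP.toℚᵘ-homo-+ (half n) (half n))
    (ℚᵘP.≃-trans (ℚᵘP.+-cong (half≃ n) (half≃ n)) (*≡* integer-identity)))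
  (ℕtoℚ≃ n)
  where
  open ℤ-Solver
  integer-identity : (+ n ℤ.* + 2 ℤ.+ + n ℤ.* + 2) ℤ.* + 1 ≡ + n ℤ.* + 4
  integer-identity = solve 1 (λ x → (x :* con (+ 2) :+ x :* con (+ 2)) :* con (+ 1) := x :* con (+ 4))
    refl (+ n)

Symbol : Set
Symbol = ℕ → ℤ → ℚ

-- op multiplies the coefficient of t^a x^n by σ n a.  (A record, so that op
-- and σ can be inferred from a proof of diagonality.)
record Diagonal (op : Op) (σ : Symbol) : Set where
  constructor diagonal
  field act : ∀ F n a → op F n a ≡ σ n a * F n a
open Diagonal

linSymbol : ℚ → ℚ → ℚ → Symbol
linSymbol α β γ n a = (α + β * ℤtoℚ a) + γ * ℕtoℚ n

lin-diagonal : ∀ α β γ → Diagonal (lin α β γ) (linSymbol α β γ)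
lin-diagonal α β γ = diagonal λ F n a → solve 6
  (λ α β γ A N f → (α :* f :+ β :* (A :* f)) :+ γ :* (N :* f) := ((α :+ β :* A) :+ γ :* N) :* f)
  refl α β γ (ℤtoℚ a) (ℕtoℚ n) (F n a)
  where open ℚ-Solver

_·ˢ_ : Symbol → Symbol → Symbol
(σ ·ˢ τ) n a = σ n a * τ n a

∘-diagonal : ∀ {op op′ σ τ} → Diagonal op σ → Diagonal op′ τ → Diagonal (op ∘ op′) (σ ·ˢ τ)
∘-diagonal {op} {op′} {σ} {τ} op-σ op′-τ = diagonal λ F n a → begin
  op (op′ F) n a         ≡⟨ act op-σ (op′ F) n a ⟩
  σ n a * op′ F n a      ≡⟨ cong (σ n a *_) (act op′-τ F n a) ⟩
  σ n a * (τ n a * F n a) ≡⟨ sym (ℚP.*-assoc (σ n a) (τ n a) (F n a)) ⟩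
  (σ ·ˢ τ) n a * F n a   ∎
  where open ≡-Reasoning

prodSymbol : (ℕ → Symbol) → ℕ → ℕ → Symbol
prodSymbol σ s zero    n a = 1ℚ
prodSymbol σ s (suc k)     = σ s ·ˢ prodSymbol σ (suc s) k

prodFrom-diagonal : ∀ {f σ} → (∀ j → Diagonal (f j) (σ j)) →
                    ∀ s k → Diagonal (prodFrom f s k) (prodSymbol σ s k)
prodFrom-diagonal f-σ s zero    = diagonal λ F n a → sym (ℚP.*-identityˡ (F n a))
prodFrom-diagonal f-σ s (suc k) = ∘-diagonal (f-σ s) (prodFrom-diagonal f-σ (suc s) k)

diagonal-local : ∀ {op σ} → Diagonal op σ → ∀ F G n a → F n a ≡ G n a → op F n a ≡ op G n a
diagonal-local {op} {σ} op-σ F G n a F≡G = begin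
  op F n a       ≡⟨ act op-σ F n a ⟩
  σ n a * F n a  ≡⟨ cong (σ n a *_) F≡G ⟩
  σ n a * G n a  ≡⟨ sym (act op-σ G n a) ⟩
  op G n a       ∎
  where open ≡-Reasoning

prodSymbol-zero : ∀ σ s k n a → prodSymbol σ s k n a ≡ 0ℚ →
                  Σ[ i ∈ ℕ ] i < k × σ (s ℕ.+ i) n a ≡ 0ℚ
prodSymbol-zero σ s zero    n a 1≡0 = contradiction 1≡0 ℚP.1≢0
prodSymbol-zero σ s (suc k) n a prod≡0 with *-zero-product (σ s n a) (prodSymbol σ (suc s) k n a) prod≡0
... | inj₁ σs≡0 = 0 , s≤s ℕ.z≤n , subst (λ j → σ j n a ≡ 0ℚ) (sym (ℕP.+-identityʳ s)) σs≡0
... | inj₂ rest≡0 with prodSymbol-zero σ (suc s) k n a rest≡0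
...   | i , i<k , σ≡0 = suc i , s≤s i<k , subst (λ j → σ j n a ≡ 0ℚ) (sym (ℕP.+-suc s i)) σ≡0

-- (a + 1) - 1 = a in ℤ: undoes the shift by the factor t.
+1-1 : ∀ a → (a ℤ.+ + 1) ℤ.- + 1 ≡ a
+1-1 a = trans (ℤP.+-assoc a (+ 1) (ℤ.- + 1)) (trans (cong (λ b → a ℤ.+ b) (ℤP.+-inverseʳ (+ 1))) (ℤP.+-identityʳ a))

module Operators (d : ℕ) where

  σR-factor σ̃R-factor : ℕ → Symbol
  σR-factor j = linSymbol (- ℕtoℚ j) (half (suc d)) (half (d ℕ.∸ 1))
  σ̃R-factor j = linSymbol (1ℚ - ℕtoℚ j) (- half (suc d)) (half (d ℕ.∸ 1))

  σR σ̃R : Symbol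
  σR = prodSymbol σR-factor 0 d
  σ̃R = prodSymbol σ̃R-factor 0 d

  D-R-diagonal : Diagonal (D-R d) σR
  D-R-diagonal = prodFrom-diagonal (λ j → lin-diagonal (- ℕtoℚ j) (half (suc d)) (half (d ℕ.∸ 1))) 0 d

  D̃-R-shifted : ∀ F n a → D̃-R d F n (a ℤ.+ + 1) ≡ σ̃R n a * F n a
  D̃-R-shifted F n a =
    trans (act (prodFrom-diagonal (λ j → lin-diagonal (1ℚ - ℕtoℚ j) (- half (suc d)) (half (d ℕ.∸ 1))) 0 d)
               F n ((a ℤ.+ + 1) ℤ.- + 1))
          (cong (λ b → σ̃R n b * F n b) (+1-1 a))

  -- Because of the factor x, the x^(m+1)-coefficients of D_L F and D̃_L F only
  -- involve x^m-coefficients of F, through a diagonal operator.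
  D-L-core-diagonal : Diagonal (lin 1ℚ (- half (suc d)) (half (d ℕ.∸ 1))
                                ∘ prodFrom (λ j → lin (ℕtoℚ j) (half d) (half d)) 1 (d ℕ.∸ 1))
                               (linSymbol 1ℚ (- half (suc d)) (half (d ℕ.∸ 1))
                                ·ˢ prodSymbol (λ j → linSymbol (ℕtoℚ j) (half d) (half d)) 1 (d ℕ.∸ 1))
  D-L-core-diagonal = ∘-diagonal (lin-diagonal 1ℚ (- half (suc d)) (half (d ℕ.∸ 1)))
    (prodFrom-diagonal (λ j → lin-diagonal (ℕtoℚ j) (half d) (half d)) 1 (d ℕ.∸ 1))

  D̃-L-core-diagonal : Diagonal (lin 0ℚ (half (suc d)) (half (d ℕ.∸ 1))
                                 ∘ prodFrom (λ j → lin (ℕtoℚ j) (- half d) (half d)) 1 (d ℕ.∸ 1))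
                                (linSymbol 0ℚ (half (suc d)) (half (d ℕ.∸ 1))
                                 ·ˢ prodSymbol (λ j → linSymbol (ℕtoℚ j) (- half d) (half d)) 1 (d ℕ.∸ 1))
  D̃-L-core-diagonal = ∘-diagonal (lin-diagonal 0ℚ (half (suc d)) (half (d ℕ.∸ 1)))
    (prodFrom-diagonal (λ j → lin-diagonal (ℕtoℚ j) (- half d) (half d)) 1 (d ℕ.∸ 1))

  D-L-local : ∀ F G m a → F m (a ℤ.- + 1) ≡ G m (a ℤ.- + 1) → D-L d F (suc m) a ≡ D-L d G (suc m) a
  D-L-local F G m a F≡G = cong (ℕtoℚ d *_) (diagonal-local D-L-core-diagonal F G m (a ℤ.- + 1) F≡G)

  D̃-L-local : ∀ F G m a → F m a ≡ G m a → D̃-L d F (suc m) a ≡ D̃-L d G (suc m) a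
  D̃-L-local F G m a F≡G = cong (ℕtoℚ d *_) (diagonal-local D̃-L-core-diagonal F G m a F≡G)

open Operators

-- Summing a factor of σ_R and a factor of σ̃_R eliminates a:
-- σR-factor j + σ̃R-factor i = 1 + (d-1)·n − (j + i).
factor-sum : ∀ d j i n a →
  σR-factor d j n a + σ̃R-factor d i n a + ℕtoℚ (j ℕ.+ i) ≡ ℕtoℚ (1 ℕ.+ (d ℕ.∸ 1) ℕ.* n)
factor-sum d j i n a = begin
  σR-factor d j n a + σ̃R-factor d i n a + ℕtoℚ (j ℕ.+ i)
    ≡⟨ cong (λ c → σR-factor d j n a + σ̃R-factor d i n a + c) (ℕtoℚ-+ j i) ⟩
  σR-factor d j n a + σ̃R-factor d i n a + (J + I)
    ≡⟨ solve 6 (λ J I H₁ H A N →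
         ((:- J :+ H₁ :* A) :+ H :* N) :+ ((con 1ℚ :- I :+ (:- H₁) :* A) :+ H :* N) :+ (J :+ I)
         := con 1ℚ :+ (H :+ H) :* N)
       refl J I (half (suc d)) (half (d ℕ.∸ 1)) (ℤtoℚ a) N ⟩
  1ℚ + (half (d ℕ.∸ 1) + half (d ℕ.∸ 1)) * N
    ≡⟨ cong (λ c → 1ℚ + c * N) (half-+-half (d ℕ.∸ 1)) ⟩
  1ℚ + ℕtoℚ (d ℕ.∸ 1) * N
    ≡⟨ sym (trans (ℕtoℚ-+ 1 ((d ℕ.∸ 1) ℕ.* n)) (cong (λ c → 1ℚ + c) (ℕtoℚ-* (d ℕ.∸ 1) n))) ⟩
  ℕtoℚ (1 ℕ.+ (d ℕ.∸ 1) ℕ.* n) ∎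
  where
  open ≡-Reasoning
  open ℚ-Solver
  J I N : ℚ
  J = ℕtoℚ j
  I = ℕtoℚ i
  N = ℕtoℚ n

-- Factor indices range over 0 … k, so j + i ≤ 2k < 1 + k·n once n ≥ 2.
indices-below-level : ∀ {k j i} n → 2 ≤ n → j ≤ k → i ≤ k → j ℕ.+ i < 1 ℕ.+ k ℕ.* n
indices-below-level {k} {j} {i} n 2≤n j≤k i≤k = s≤s (begin
  j ℕ.+ i   ≤⟨ ℕP.+-mono-≤ j≤k i≤k ⟩
  k ℕ.+ k   ≡⟨ cong (k ℕ.+_) (sym (ℕP.+-identityʳ k)) ⟩
  2 ℕ.* k   ≡⟨ ℕP.*-comm 2 k ⟩
  k ℕ.* 2   ≤⟨ ℕP.*-monoʳ-≤ k 2≤n ⟩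
  k ℕ.* n   ∎)
  where open ℕP.≤-Reasoning

symbols-apart : ∀ k m a → let n = suc (suc m) in
                ¬ (σR (suc k) n a ≡ 0ℚ × σ̃R (suc k) n a ≡ 0ℚ)
symbols-apart k m a (σR≡0 , σ̃R≡0)
  with prodSymbol-zero (σR-factor (suc k)) 0 (suc k) (suc (suc m)) a σR≡0
     | prodSymbol-zero (σ̃R-factor (suc k)) 0 (suc k) (suc (suc m)) a σ̃R≡0
... | j , s≤s j≤k , factorⱼ≡0 | i , s≤s i≤k , factorᵢ≡0 =
  ℕP.<⇒≢ (indices-below-level n (s≤s (s≤s ℕ.z≤n)) j≤k i≤k) indices-sum
  where
  n : ℕ
  n = suc (suc m)
  indices-sum : j ℕ.+ i ≡ 1 ℕ.+ k ℕ.* n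
  indices-sum = ℕtoℚ-injective _ _ (begin
    ℕtoℚ (j ℕ.+ i)                  ≡⟨ sym (ℚP.+-identityˡ _) ⟩
    0ℚ + 0ℚ + ℕtoℚ (j ℕ.+ i)        ≡⟨ cong₂ (λ x y → x + y + ℕtoℚ (j ℕ.+ i)) (sym factorⱼ≡0) (sym factorᵢ≡0) ⟩
    σR-factor (suc k) j n a + σ̃R-factor (suc k) i n a + ℕtoℚ (j ℕ.+ i) ≡⟨ factor-sum (suc k) j i n a ⟩
    ℕtoℚ (1 ℕ.+ k ℕ.* n)            ∎)
    where open ≡-Reasoning

module Uniqueness (d : ℕ)
  (apart : ∀ m a → ¬ (σR d (suc (suc m)) a ≡ 0ℚ × σ̃R d (suc (suc m)) a ≡ 0ℚ))
  (F G : R) (F-solves : Solves d F) (G-solves : Solves d G) where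

  open ≡-Reasoning

  f g : Coeffs
  f = coeff F
  g = coeff G

  σR-determined : ∀ m → (∀ b → f (suc m) b ≡ g (suc m) b) → ∀ a →
                  σR d (suc (suc m)) a * f (suc (suc m)) a ≡ σR d (suc (suc m)) a * g (suc (suc m)) a
  σR-determined m lower a = begin
    σR d n a * f n a  ≡⟨ sym (act (D-R-diagonal d) f n a) ⟩
    D-R d f n a       ≡⟨ sym (proj₁ F-solves n a) ⟩
    D-L d f n a       ≡⟨ D-L-local d f g (suc m) a (lower _) ⟩
    D-L d g n a       ≡⟨ proj₁ G-solves n a ⟩
    D-R d g n a       ≡⟨ act (D-R-diagonal d) g n a ⟩
    σR d n a * g n a  ∎
    where
    n : ℕ
    n = suc (suc m)

  -- D̃_L F = D̃_R F, read at t^(a+1) x^(m+2), does the same for σ̃_R·F.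
  σ̃R-determined : ∀ m → (∀ b → f (suc m) b ≡ g (suc m) b) → ∀ a →
                  σ̃R d (suc (suc m)) a * f (suc (suc m)) a ≡ σ̃R d (suc (suc m)) a * g (suc (suc m)) a
  σ̃R-determined m lower a = begin
    σ̃R d n a * f n a  ≡⟨ sym (D̃-R-shifted d f n a) ⟩
    D̃-R d f n a′      ≡⟨ sym (proj₂ F-solves n a′) ⟩
    D̃-L d f n a′      ≡⟨ D̃-L-local d f g (suc m) a′ (lower a′) ⟩
    D̃-L d g n a′      ≡⟨ proj₂ G-solves n a′ ⟩
    D̃-R d g n a′      ≡⟨ D̃-R-shifted d g n a ⟩
    σ̃R d n a * g n a  ∎
    where
    n : ℕ
    n  = suc (suc m)
    a′ : ℤ
    a′ = a ℤ.+ + 1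

  agree : (∀ a → f 0 a ≡ g 0 a) → (∀ a → f 1 a ≡ g 1 a) → ∀ n a → f n a ≡ g n a
  agree level₀ level₁ zero          a = level₀ a
  agree level₀ level₁ (suc zero)    a = level₁ a
  agree level₀ level₁ (suc (suc m)) a =
    cancel-by-either (σR d (suc (suc m)) a) (σ̃R d (suc (suc m)) a) _ _ (apart m a)
      (σR-determined m (agree level₀ level₁ (suc m)) a)
      (σ̃R-determined m (agree level₀ level₁ (suc m)) a)

-- The theorem: two solutions with F ≡ G ≡ 1 + t x (mod x²) agree at levels 0
-- and 1, and the symbols are apart for every d = k + 1 (so d ≥ 1 already suffices).
proposition6p1 : (d : ℕ) → 2 ≤ d → (F G : R) →
    Solves d F → InitCond F → Solves d G → InitCond G → F ≈R G
proposition6p1 zero () F G F-solves F-init G-solves G-init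
proposition6p1 (suc k) _ F G F-solves F-init G-solves G-init =
  Uniqueness.agree (suc k) (symbols-apart k) F G F-solves G-solves
    (λ a → trans (proj₁ F-init a) (sym (proj₁ G-init a)))
    (λ a → trans (proj₂ F-init a) (sym (proj₂ G-init a)))
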